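{- Let $p$ be a prime and $r,s \in \{0,1,\dots,p-1\}$. If $(r,s) \in D(p)$, then $(r, r-s) \in D(p)$.
   Context: For a prime $p$, $D(p)$ denotes the set of pairs $(r,s) \in \{0,1,\dots,p-1\}^2$ such that $\binom{pa+r}{pb+s} \equiv \binom{a}{b}\binom{r}{s} \pmod{p^2}$ for all integers $a \geq 0$ and $b \geq 0$. Binomial coefficients $\binom{n}{k}$ with $k > n \geq 0$ are $0$. -}

module Defs where

open import Data.Nat using (ℕ; _+_; _*_; _^_; _<_)
open import Data.Nat.Combinatorics using (_C_)
open import Data.Product using (_×_)
open import Data.Integer using (ℤ; +_; _-_)
open import Data.Integer.Divisibility using (_∣_)

_≡_[mod_] : ℕ → ℕ → ℕ → Set
x ≡ y [mod m ] = (+ m) ∣ ((+ x) - (+ y))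

-- (r , s) ∈ D(p): r, s ∈ {0,…,p-1} and for all a, b ≥ 0,
-- C(pa+r, pb+s) ≡ C(a,b) C(r,s) (mod p²).   (_C_ is 0 when k > n.)
InD : ℕ → ℕ → ℕ → Set
InD p r s =
  r < p × s < p ×
  (∀ (a b : ℕ) → ((p * a + r) C (p * b + s)) ≡ ((a C b) * (r C s)) [mod p ^ 2 ])

module Submission where

-- (1) s ≤ r.  Otherwise r < s and the instance a = 1, b = 0 of the defining
--     congruence reads C(p + r, s) ≡ C(1,0) C(r,s) = 0 (mod p²).  But
--     C(p + r, s) · s! is the falling factorial (p + r)(p + r - 1)⋯(p + r - s + 1),
--     whose factors lie in (0, 2p) and contain the multiple p exactly once;
--     so it equals p · Q with p ∤ Q, and p² ∣ p · Q is impossible.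
-- (2) (r , r - s) ∈ D(p) by the symmetry C(n, k) = C(n, n - k).  For b ≤ a,
--     (pa + r) - (pb + (r - s)) = p(a - b) + s, hence
--     C(pa + r, pb + (r - s)) = C(pa + r, p(a - b) + s) and
--     C(a, b) C(r, r - s) = C(a, a - b) C(r, s), so the congruence for
--     (r , r - s) at (a , b) is the one for (r , s) at (a , a - b).
--     For b > a both sides vanish, since pa + r < pb.

open import Defs
open import Data.Nat using (ℕ; _∸_; _≤_; _<_)
open import Data.Nat.Primality using (Prime)
open import Data.Product using (_×_)

open import Data.Nat.Base using (zero; suc; _+_; _*_; _^_; _!; z≤n; s≤s; _≤ᵇ_; nonTrivial⇒n>1)
open import Data.Nat.Properties
open import Data.Nat.Divisibility as ℕ using (∣⇒≤; _∣0; ∣m+n∣m⇒∣n; ∣-refl; ∣m⇒∣m*n; *-cancelˡ-∣)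
open import Data.Nat.DivMod using (_/_; m/n*n≡m)
open import Data.Nat.Primality using (euclidsLemma; prime⇒nonZero; prime⇒nonTrivial)
open import Data.Nat.Combinatorics using (_C_; _P_; nCk≡nPk/k!; nCk≡nC[n∸k]; k>n⇒nCk≡0)
open import Data.Nat.Combinatorics.Base using (_P′_)
open import Data.Nat.Combinatorics.Specification using (k!∣nP′k)
open import Data.Product using (Σ-syntax; _,_)
open import Data.Sum using (inj₁; inj₂; [_,_]′)
open import Data.Bool using (true; false; T)
open import Relation.Nullary using (¬_; yes; no; contradiction)
open import Relation.Binary.PropositionalEquality
open import Data.Integer using (+_)
open import Data.Integer.Properties using (+-inverseʳ)
import Data.Integer.Divisibility as ℤ
open import Algebra.Properties.CommutativeSemigroup *-commutativeSemigroup using (x∙yz≈y∙xz)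
open import Algebra.Properties.CommutativeSemigroup +-commutativeSemigroup using (interchange)

¬∣-below : ∀ {p x} → 0 < x → x < p → ¬ (p ℕ.∣ x)
¬∣-below {x = suc x} _ x<p p∣x = <⇒≱ x<p (∣⇒≤ p∣x)

¬∣-* : ∀ {p x y} → Prime p → ¬ (p ℕ.∣ x) → ¬ (p ℕ.∣ y) → ¬ (p ℕ.∣ x * y)
¬∣-* {x = x} {y} pp p∤x p∤y p∣xy = [ p∤x , p∤y ]′ (euclidsLemma x y pp p∣xy)

≡-mod-refl : ∀ {m x} → x ≡ x [mod m ]
≡-mod-refl {m} {x} = subst ((+ m) ℤ.∣_) (sym (+-inverseʳ (+ x))) (m ∣0)

≡0-mod⇒∣ : ∀ {m x} → x ≡ 0 [mod m ] → m ℕ.∣ x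
≡0-mod⇒∣ {m} {x} m∣x+0 = subst (m ℕ.∣_) (+-identityʳ x) m∣x+0

≡-mod-subst : ∀ {m x x′ y y′} → x ≡ x′ → y ≡ y′ → x ≡ y [mod m ] → x′ ≡ y′ [mod m ]
≡-mod-subst refl refl x≡y = x≡y

nPk≡nP′k : ∀ {n k} → k ≤ n → n P k ≡ n P′ k
nPk≡nP′k {n} {k} k≤n with k ≤ᵇ n in eq
... | true  = refl
... | false = contradiction (≤⇒≤ᵇ k≤n) (subst T eq)

nCk*k!≡nP′k : ∀ {n k} → k ≤ n → (n C k) * k ! ≡ n P′ k
nCk*k!≡nP′k {n} {k} k≤n = begin
    (n C k) * k !
  ≡⟨ cong (_* k !) (nCk≡nPk/k! k≤n) ⟩
    ((n P k) / k !) * k !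
  ≡⟨ cong (λ z → (z / k !) * k !) (nPk≡nP′k k≤n) ⟩
    ((n P′ k) / k !) * k !
  ≡⟨ m/n*n≡m (k!∣nP′k k≤n) ⟩
    n P′ k ∎
  where open ≡-Reasoning
        instance _ = k !≢0

-- The falling factorial of p + r, for a prime p and r < p.  Its factors are
-- p + r, p + r - 1, …, and the only multiple of p among the first p + r of
-- them is the factor p, reached at position r.
module FallingFactorial {p : ℕ} (pp : Prime p) {r : ℕ} (r<p : r < p) where

  -- Before the factor p is reached, all factors lie strictly between p and 2p.
  falling-unit : ∀ k → k ≤ r → ¬ (p ℕ.∣ (p + r) P′ k)
  falling-unit zero    _   = ¬∣-below (s≤s z≤n) (nonTrivial⇒n>1 p {{prime⇒nonTrivial pp}})
  falling-unit (suc k) k<r = ¬∣-* pp p∤factor (falling-unit k (<⇒≤ k<r))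
    where
      p∤factor : ¬ (p ℕ.∣ p + r ∸ k)
      p∤factor p∣factor = ¬∣-below (m<n⇒0<n∸m k<r) (≤-<-trans (m∸n≤m r k) r<p)
        (∣m+n∣m⇒∣n (subst (p ℕ.∣_) (+-∸-assoc p (<⇒≤ k<r)) p∣factor) ∣-refl)

  falling-once : ∀ k → r < k → k ≤ p + r → Σ[ Q ∈ ℕ ] ((p + r) P′ k ≡ p * Q × ¬ (p ℕ.∣ Q))
  falling-once (suc k) (s≤s r≤k) k<p+r with m≤n⇒m<n∨m≡n r≤k
  ... | inj₂ refl = (p + r) P′ r , cong (_* ((p + r) P′ r)) (m+n∸n≡m p r) , falling-unit r ≤-refl
  ... | inj₁ r<k  with falling-once k r<k (<⇒≤ k<p+r)
  ...   | Q , P′≡pQ , p∤Q = (p + r ∸ k) * Q , P′≡p[factor*Q] , ¬∣-* pp p∤factor p∤Q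
    where
      P′≡p[factor*Q] : (p + r ∸ k) * ((p + r) P′ k) ≡ p * ((p + r ∸ k) * Q)
      P′≡p[factor*Q] = trans (cong ((p + r ∸ k) *_) P′≡pQ) (x∙yz≈y∙xz (p + r ∸ k) p Q)
      factor<p : p + r ∸ k < p
      factor<p = begin-strict
          p + r ∸ k  <⟨ ∸-monoˡ-< (+-monoʳ-< p r<k) (<⇒≤ k<p+r) ⟩
          p + k ∸ k  ≡⟨ m+n∸n≡m p k ⟩
          p          ∎
        where open ≤-Reasoning
      p∤factor : ¬ (p ℕ.∣ p + r ∸ k)
      p∤factor = ¬∣-below (m<n⇒0<n∸m k<p+r) factor<p

  binomial-¬∣p² : ∀ k → r < k → k ≤ p + r → ¬ (p * p ℕ.∣ (p + r) C k)
  binomial-¬∣p² k r<k k≤p+r p²∣C with falling-once k r<k k≤p+r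
  ... | Q , P′≡pQ , p∤Q = p∤Q (*-cancelˡ-∣ p {{prime⇒nonZero pp}} p²∣pQ)
    where
      p²∣pQ : p * p ℕ.∣ p * Q
      p²∣pQ = subst (p * p ℕ.∣_) (trans (nCk*k!≡nP′k k≤p+r) P′≡pQ) (∣m⇒∣m*n (k !) p²∣C)

-- Step (1): a pair in D(p) has s ≤ r.  For r < s, the case a = 1, b = 0
-- would force p² ∣ C(p + r, s), contradicting binomial-¬∣p².
InD⇒s≤r : ∀ {p r s} → Prime p → InD p r s → s ≤ r
InD⇒s≤r {p} {r} {s} pp (r<p , s<p , congruent) with s ≤? r
... | yes s≤r = s≤r
... | no  s≰r = contradiction p²∣C (binomial-¬∣p² s r<s s≤p+r)
  where
    open FallingFactorial pp r<p
    r<s : r < s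
    r<s = ≰⇒> s≰r
    s≤p+r : s ≤ p + r
    s≤p+r = ≤-trans (<⇒≤ s<p) (m≤m+n p r)
    C≡0 : ((p * 1 + r) C (p * 0 + s)) ≡ 0 [mod p ^ 2 ]
    C≡0 = ≡-mod-subst refl (cong ((1 C 0) *_) (k>n⇒nCk≡0 r<s)) (congruent 1 0)
    p²∣C : p * p ℕ.∣ (p + r) C s
    p²∣C = subst₂ ℕ._∣_ (cong (p *_) (*-identityʳ p))
             (cong₂ _C_ (cong (_+ r) (*-identityʳ p)) (cong (_+ s) (*-zeroʳ p)))
             (≡0-mod⇒∣ C≡0)

lifted-vanish : ∀ {p r} t {a b} → r < p → a < b → (p * a + r) C (p * b + t) ≡ 0
lifted-vanish {p} {r} t {a} {b} r<p a<b = k>n⇒nCk≡0 (begin-strict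
    p * a + r   <⟨ +-monoʳ-< (p * a) r<p ⟩
    p * a + p   ≡⟨ trans (+-comm (p * a) p) (sym (*-suc p a)) ⟩
    p * suc a   ≤⟨ *-monoʳ-≤ p a<b ⟩
    p * b       ≤⟨ m≤m+n (p * b) t ⟩
    p * b + t   ∎)
  where open ≤-Reasoning

lifted-reflect : ∀ p {r s a b} → s ≤ r → b ≤ a →
  (p * a + r) C (p * b + (r ∸ s)) ≡ (p * a + r) C (p * (a ∸ b) + s)
lifted-reflect p {r} {s} {a} {b} s≤r b≤a =
  trans (nCk≡nC[n∸k] k≤n) (cong ((p * a + r) C_) n∸k≡complement)
  where
    n≡k+complement : p * a + r ≡ (p * b + (r ∸ s)) + (p * (a ∸ b) + s)
    n≡k+complement = begin
        p * a + r
      ≡⟨ cong₂ _+_ (cong (p *_) (sym (m+[n∸m]≡n b≤a))) (sym (m∸n+n≡m s≤r)) ⟩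
        p * (b + (a ∸ b)) + ((r ∸ s) + s)
      ≡⟨ cong (_+ ((r ∸ s) + s)) (*-distribˡ-+ p b (a ∸ b)) ⟩
        (p * b + p * (a ∸ b)) + ((r ∸ s) + s)
      ≡⟨ interchange (p * b) (p * (a ∸ b)) (r ∸ s) s ⟩
        (p * b + (r ∸ s)) + (p * (a ∸ b) + s) ∎
      where open ≡-Reasoning
    k≤n : p * b + (r ∸ s) ≤ p * a + r
    k≤n = subst (p * b + (r ∸ s) ≤_) (sym n≡k+complement) (m≤m+n _ _)
    n∸k≡complement : p * a + r ∸ (p * b + (r ∸ s)) ≡ p * (a ∸ b) + s
    n∸k≡complement = trans (cong (_∸ (p * b + (r ∸ s))) n≡k+complement)
                           (m+n∸m≡n (p * b + (r ∸ s)) (p * (a ∸ b) + s))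

product-reflect : ∀ {r s a b} → s ≤ r → b ≤ a →
  (a C b) * (r C (r ∸ s)) ≡ (a C (a ∸ b)) * (r C s)
product-reflect {r} {s} s≤r b≤a = cong₂ _*_ (nCk≡nC[n∸k] b≤a)
  (trans (nCk≡nC[n∸k] (m∸n≤m r s)) (cong (r C_) (m∸[m∸n]≡n s≤r)))

InD-reflect : ∀ {p r s} → s ≤ r → InD p r s → InD p r (r ∸ s)
InD-reflect {p} {r} {s} s≤r (r<p , s<p , congruent) =
  r<p , ≤-<-trans (m∸n≤m r s) r<p , reflected
  where
    reflected : ∀ a b → ((p * a + r) C (p * b + (r ∸ s))) ≡ ((a C b) * (r C (r ∸ s))) [mod p ^ 2 ]
    reflected a b with b ≤? a
    ... | yes b≤a = ≡-mod-subst (sym (lifted-reflect p s≤r b≤a)) (sym (product-reflect s≤r b≤a))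
                      (congruent a (a ∸ b))
    ... | no  b≰a = ≡-mod-subst (sym (lifted-vanish (r ∸ s) r<p (≰⇒> b≰a)))
                      (sym (cong (_* (r C (r ∸ s))) (k>n⇒nCk≡0 (≰⇒> b≰a))))
                      (≡-mod-refl {x = 0})

proposition5 : ∀ (p r s : ℕ) → Prime p → r < p → s < p →
    InD p r s → s ≤ r × InD p r (r ∸ s)
proposition5 p r s pp r<p s<p inD = s≤r , InD-reflect s≤r inD
  where
    s≤r : s ≤ r
    s≤r = InD⇒s≤r pp inD
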